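{- For every integer $m\ge1$, let $\mathbb{D}_m$ be the key diagram of the weak composition $(0,m,m,\dots,m)$ with $m$ entries equal to $m$, i.e. $\mathbb{D}_m=\{(i,j):2\le i\le m+1,\ 1\le j\le m\}$. Then $|KD(\mathbb{D}_m)|=\binom{2m}{m}$.
   Context: A diagram is a finite set $D$ of cells $(r,c)$ with $r,c$ positive integers; $r$ is the row (rows numbered from bottom to top starting at 1) and $c$ the column (numbered from left to right starting at 1). A Kohnert move at row $r$ applied to a diagram $D$: if row $r$ of $D$ is empty, $D$ is unchanged; otherwise let $(r,c)$ be the cell of row $r$ with the largest column index; if every position $(r',c)$ with $1\le r'<r$ belongs to $D$, then $D$ is unchanged; otherwise let $r'$ be the largest integer with $1\le r'<r$ and $(r',c)\notin D$, and the move replaces the cell $(r,c)$ by $(r',c)$. For a diagram $D_0$, $KD(D_0)$ is the set of all diagrams obtainable from $D_0$ by finite (possibly empty) sequences of Kohnert moves (including $D_0$ itself). -}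

module Defs where

open import Data.Nat using (ℕ; zero; suc; _≤_; _<_; _+_)
open import Data.Product using (_×_; _,_; ∃; ∃-syntax; Σ)
open import Data.Sum using (_⊎_)
open import Data.List using (List; []; _∷_; map; concatMap; upTo; length)
open import Data.List.Membership.Propositional using (_∈_; _∉_)
open import Data.List.Relation.Unary.Any using (Any)
open import Data.List.Relation.Unary.AllPairs using (AllPairs)
open import Relation.Binary.PropositionalEquality using (_≡_; _≢_)
open import Relation.Nullary using (¬_)
open import Function.Bundles using (_⇔_)

-- A cell is (row , column); rows numbered bottom-to-top from 1, columns left-to-right from 1.
Cell : Set
Cell = ℕ × ℕ

-- A diagram is a finite set of cells, represented by a list of cells
-- (order and repetitions irrelevant; diagrams are compared by set equality _≈D_).
Diagram : Set
Diagram = List Cell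

_≈D_ : Diagram → Diagram → Set
D ≈D E = ∀ x → (x ∈ D) ⇔ (x ∈ E)

RowMax : Diagram → ℕ → ℕ → Set
RowMax D r c = ((r , c) ∈ D) × (∀ c' → (r , c') ∈ D → c' ≤ c)

-- A non-trivial Kohnert move at row r taking D to E: the rightmost cell (r , c)
-- of row r moves down to (r' , c), where r' is the largest index with
-- 1 ≤ r' < r and (r' , c) ∉ D.  (Moves that leave D unchanged are covered by
-- reflexivity of the reachability relation below.)
KohnertMove : ℕ → Diagram → Diagram → Set
KohnertMove r D E =
  ∃[ c ] ∃[ r' ]
    ( RowMax D r c
    × 1 ≤ r' × r' < r
    × (r' , c) ∉ D
    × (∀ r'' → r' < r'' → r'' < r → (r'' , c) ∈ D)
    × (∀ x → (x ∈ E) ⇔ (((x ∈ D) × (x ≢ (r , c))) ⊎ (x ≡ (r' , c)))) )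

-- Reachable D₀ D : D is obtained from D₀ by a finite sequence of Kohnert moves,
-- i.e. D ∈ KD(D₀) (up to set equality of diagrams).
data Reachable (D₀ : Diagram) : Diagram → Set where
  base : ∀ {D} → D ≈D D₀ → Reachable D₀ D
  step : ∀ {D E} r → Reachable D₀ D → KohnertMove r D E → Reachable D₀ E

-- |KD(D₀)| = n : there is a list of pairwise distinct (as sets) diagrams of
-- length n whose members are exactly the elements of KD(D₀).
KDCard : Diagram → ℕ → Set
KDCard D₀ n =
  Σ (List Diagram) λ L →
      (∀ D → Reachable D₀ D ⇔ Any (D ≈D_) L)
    × AllPairs (λ A B → ¬ (A ≈D B)) L
    × length L ≡ n

𝔻 : ℕ → Diagram
𝔻 m = concatMap (λ i → map (λ j → (suc (suc i) , suc j)) (upTo m)) (upTo m)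

{-# OPTIONS --safe #-}
-- Every diagram in KD(𝔻 m) is the box of rows 1…m+1 and columns 1…m with exactly one empty
-- cell per column, whose rows f 1 ≤ … ≤ f m weakly increase.  Initially f ≡ 1; a Kohnert move
-- at row r sends the rightmost cell (r , c) down into the hole of column c, which raises f c to r,
-- and every column right of c already has its hole at r, so monotonicity is preserved.
-- Conversely each weakly increasing f is reached by raising holes suffix by suffix, each suffix
-- from right to left.  Such f are the weakly increasing sequences of length m in [0, m] after a
-- shift, and Pascal's rule counts them as C(2m, m).
module Submission where

open import Defs
open import Data.Nat using (ℕ; zero; suc; _+_; _∸_; _*_; _≤_; _<_; _≥_; z≤n; s≤s; pred; _≟_; _≤?_; _⊓_; >-nonZero)
open import Data.Nat.Properties
open import Data.Nat.Combinatorics using (_C_; nCn≡1; nCk+nC[k+1]≡[n+1]C[k+1])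
open import Data.List using (List; []; _∷_; map; _++_; length; upTo; applyUpTo; filter; cartesianProduct)
open import Data.List.Properties using (length-++; length-map; map-injective; ∷-injectiveʳ)
open import Data.List.Membership.Propositional using (_∈_; _∉_; find; lose)
open import Data.List.Membership.Propositional.Properties
open import Data.List.Relation.Unary.Any using (Any; here; there)
import Data.List.Relation.Unary.Any.Properties as Any
open import Data.List.Relation.Unary.All using (All; []; _∷_)
import Data.List.Relation.Unary.All as All
import Data.List.Relation.Unary.All.Properties as All
open import Data.List.Relation.Unary.AllPairs using (AllPairs; []; _∷_)
import Data.List.Relation.Unary.AllPairs as AllPairs
import Data.List.Relation.Unary.AllPairs.Properties as AllPairs
open import Data.Product using (_×_; _,_; ∃-syntax; proj₁; proj₂)
open import Data.Product.Function.NonDependent.Propositional using (_×-⇔_)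
open import Data.Sum using (_⊎_; inj₁; inj₂)
open import Data.Sum.Function.Propositional using (_⊎-⇔_)
open import Data.Empty using (⊥-elim)
open import Function using (_∘_; const)
open import Function.Bundles using (_⇔_; mk⇔; Equivalence)
import Function.Properties.Equivalence as ⇔
open import Relation.Nullary using (¬_; Dec; yes; no)
open import Relation.Nullary.Decidable using (¬?; decidable-stable)
open import Relation.Binary.PropositionalEquality

open Equivalence using (to; from)

allPairs-mapWith∈ : ∀ {A : Set} {R S : A → A → Set} {xs} →
                    (∀ {x y} → x ∈ xs → y ∈ xs → R x y → S x y) → AllPairs R xs → AllPairs S xs
allPairs-mapWith∈ R⇒S []         = []
allPairs-mapWith∈ R⇒S (Rx ∷ Rxs) =
  All.tabulate (λ y∈ → R⇒S (here refl) (there y∈) (All.lookup Rx y∈))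
  ∷ allPairs-mapWith∈ (λ x∈ y∈ → R⇒S (there x∈) (there y∈)) Rxs

∈-applyUpTo-suc : ∀ {n a} → a ∈ applyUpTo suc n ⇔ (1 ≤ a × a ≤ n)
∈-applyUpTo-suc = mk⇔ forward backward
  where
  forward : ∀ {n a} → a ∈ applyUpTo suc n → 1 ≤ a × a ≤ n
  forward a∈ with i , i<n , refl ← ∈-applyUpTo⁻ suc a∈ = s≤s z≤n , i<n
  backward : ∀ {n a} → 1 ≤ a × a ≤ n → a ∈ applyUpTo suc n
  backward {a = suc i} (_ , i<n) = ∈-applyUpTo⁺ suc i<n

-- Out of range the entry is 0.
nth : List ℕ → ℕ → ℕ
nth []       _       = 0
nth (x ∷ xs) zero    = x
nth (x ∷ xs) (suc i) = nth xs i

nth-map-suc : ∀ xs {i} → i < length xs → nth (map suc xs) i ≡ suc (nth xs i)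
nth-map-suc (x ∷ xs) {zero}  _         = refl
nth-map-suc (x ∷ xs) {suc i} (s≤s i<n) = nth-map-suc xs i<n

nth-ext : ∀ xs ys → length xs ≡ length ys → (∀ i → i < length xs → nth xs i ≡ nth ys i) → xs ≡ ys
nth-ext []       []       _   _  = refl
nth-ext (x ∷ xs) (y ∷ ys) len eq =
  cong₂ _∷_ (eq 0 (s≤s z≤n)) (nth-ext xs ys (suc-injective len) (λ i i<n → eq (suc i) (s≤s i<n)))

-- Weakly increasing lists of length k with entries in [0, n]: those starting with 0, then the rest shifted up by one.
ascendingLists : ℕ → ℕ → List (List ℕ)
ascendingLists zero    n       = [] ∷ []
ascendingLists (suc k) zero    = map (0 ∷_) (ascendingLists k zero)
ascendingLists (suc k) (suc n) =
  map (0 ∷_) (ascendingLists k (suc n)) ++ map (map suc) (ascendingLists (suc k) n)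

length-ascendingLists : ∀ k n → length (ascendingLists k n) ≡ (k + n) C k
length-ascendingLists zero    n       = refl
length-ascendingLists (suc k) zero    = begin
  length (map (0 ∷_) (ascendingLists k 0)) ≡⟨ length-map (0 ∷_) (ascendingLists k 0) ⟩
  length (ascendingLists k 0)              ≡⟨ length-ascendingLists k 0 ⟩
  (k + 0) C k                              ≡⟨ cong (_C k) (+-identityʳ k) ⟩
  k C k                                    ≡⟨ trans (nCn≡1 k) (sym (nCn≡1 (suc k))) ⟩
  suc k C suc k                            ≡⟨ cong (_C suc k) (sym (+-identityʳ (suc k))) ⟩
  (suc k + 0) C suc k                      ∎
  where open ≡-Reasoning
length-ascendingLists (suc k) (suc n) = begin
  length (map (0 ∷_) (ascendingLists k (suc n)) ++ map (map suc) (ascendingLists (suc k) n))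
    ≡⟨ length-++ (map (0 ∷_) (ascendingLists k (suc n))) ⟩
  length (map (0 ∷_) (ascendingLists k (suc n))) + length (map (map suc) (ascendingLists (suc k) n))
    ≡⟨ cong₂ _+_ (length-map (0 ∷_) (ascendingLists k (suc n)))
                 (length-map (map suc) (ascendingLists (suc k) n)) ⟩
  length (ascendingLists k (suc n)) + length (ascendingLists (suc k) n)
    ≡⟨ cong₂ _+_ (length-ascendingLists k (suc n)) (length-ascendingLists (suc k) n) ⟩
  (k + suc n) C k + (suc k + n) C suc k
    ≡⟨ cong (λ N → (k + suc n) C k + N C suc k) (sym (+-suc k n)) ⟩
  (k + suc n) C k + (k + suc n) C suc k
    ≡⟨ nCk+nC[k+1]≡[n+1]C[k+1] (k + suc n) k ⟩
  (suc k + suc n) C suc k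
    ∎
  where open ≡-Reasoning

Ascending : ℕ → ℕ → (ℕ → ℕ) → Set
Ascending k n F = (∀ i → i < k → F i ≤ n) × (∀ i j → i ≤ j → j < k → F i ≤ F j)

record AscendingList (k n : ℕ) (xs : List ℕ) : Set where
  constructor ascendingList
  field
    length≡   : length xs ≡ k
    ascending : Ascending k n (nth xs)

ascending-tail : ∀ {k n F} → Ascending (suc k) n F → Ascending k n (F ∘ suc)
ascending-tail (bound , mono) = (λ i i<k → bound (suc i) (s≤s i<k))
                              , (λ i j i≤j j<k → mono (suc i) (suc j) (s≤s i≤j) (s≤s j<k))

ascending-pred : ∀ {k n F} → Ascending k (suc n) F → Ascending k n (pred ∘ F)
ascending-pred (bound , mono) =
  (λ i i<k → pred-mono-≤ (bound i i<k)) , (λ i j i≤j j<k → pred-mono-≤ (mono i j i≤j j<k))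

ascendingList-0∷ : ∀ {k n xs} → AscendingList k n xs → AscendingList (suc k) n (0 ∷ xs)
ascendingList-0∷ {k} {n} {xs} (ascendingList len (bound , mono)) = ascendingList (cong suc len) (bound′ , mono′)
  where
  bound′ : ∀ i → i < suc k → nth (0 ∷ xs) i ≤ n
  bound′ zero    _         = z≤n
  bound′ (suc i) (s≤s i<k) = bound i i<k
  mono′ : ∀ i j → i ≤ j → j < suc k → nth (0 ∷ xs) i ≤ nth (0 ∷ xs) j
  mono′ zero    _       _         _         = z≤n
  mono′ (suc i) (suc j) (s≤s i≤j) (s≤s j<k) = mono i j i≤j j<k

ascendingList-map-suc : ∀ {k n xs} → AscendingList k n xs → AscendingList k (suc n) (map suc xs)
ascendingList-map-suc {k} {n} {xs} (ascendingList len (bound , mono)) =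
  ascendingList (trans (length-map suc xs) len) (bound′ , mono′)
  where
  nth-suc : ∀ {i} → i < k → nth (map suc xs) i ≡ suc (nth xs i)
  nth-suc i<k = nth-map-suc xs (subst (_ <_) (sym len) i<k)
  bound′ : ∀ i → i < k → nth (map suc xs) i ≤ suc n
  bound′ i i<k rewrite nth-suc i<k = s≤s (bound i i<k)
  mono′ : ∀ i j → i ≤ j → j < k → nth (map suc xs) i ≤ nth (map suc xs) j
  mono′ i j i≤j j<k rewrite nth-suc (≤-<-trans i≤j j<k) | nth-suc j<k = s≤s (mono i j i≤j j<k)

ascendingLists-sound : ∀ k n → All (AscendingList k n) (ascendingLists k n)
ascendingLists-sound zero    n       = ascendingList refl ((λ _ ()) , (λ _ _ _ ())) ∷ []
ascendingLists-sound (suc k) zero    = All.map⁺ (All.map ascendingList-0∷ (ascendingLists-sound k zero))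
ascendingLists-sound (suc k) (suc n) = All.++⁺
  (All.map⁺ (All.map ascendingList-0∷ (ascendingLists-sound k (suc n))))
  (All.map⁺ (All.map ascendingList-map-suc (ascendingLists-sound (suc k) n)))

0∷-∈-ascendingLists : ∀ {k n xs} → xs ∈ ascendingLists k n → 0 ∷ xs ∈ ascendingLists (suc k) n
0∷-∈-ascendingLists {n = zero}  xs∈ = ∈-map⁺ (0 ∷_) xs∈
0∷-∈-ascendingLists {n = suc n} xs∈ = ∈-++⁺ˡ (∈-map⁺ (0 ∷_) xs∈)

ascendingLists-complete : ∀ k n F → Ascending k n F →
                          ∃[ xs ] xs ∈ ascendingLists k n × (∀ i → i < k → nth xs i ≡ F i)
ascendingLists-complete zero    n F _ = [] , here refl , λ _ ()
ascendingLists-complete (suc k) n F asc with F 0 ≟ 0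
... | yes F0≡0 with xs , xs∈ , eq ← ascendingLists-complete k n (F ∘ suc) (ascending-tail asc) =
  0 ∷ xs , 0∷-∈-ascendingLists {k} {n} xs∈ , λ { zero _ → sym F0≡0 ; (suc i) (s≤s i<k) → eq i i<k }
ascendingLists-complete (suc k) zero    F (bound , _) | no F0≢0 = ⊥-elim (F0≢0 (n≤0⇒n≡0 (bound 0 (s≤s z≤n))))
ascendingLists-complete (suc k) (suc n) F asc         | no F0≢0
  with xs , xs∈ , eq ← ascendingLists-complete (suc k) n (pred ∘ F) (ascending-pred asc) =
  map suc xs , ∈-++⁺ʳ (map (0 ∷_) (ascendingLists k (suc n))) (∈-map⁺ (map suc) xs∈) , eq′
  where
  eq′ : ∀ i → i < suc k → nth (map suc xs) i ≡ F i
  eq′ i i<k = begin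
    nth (map suc xs) i  ≡⟨ nth-map-suc xs (subst (i <_) (sym length≡) i<k) ⟩
    suc (nth xs i)      ≡⟨ cong suc (eq i i<k) ⟩
    suc (pred (F i))    ≡⟨ suc-pred (F i) {{>-nonZero 0<Fi}} ⟩
    F i                 ∎
    where
    open ≡-Reasoning
    open AscendingList (All.lookup (ascendingLists-sound (suc k) n) xs∈) using (length≡)
    0<Fi : 0 < F i
    0<Fi = <-≤-trans (n≢0⇒n>0 F0≢0) (proj₂ asc 0 i z≤n i<k)

0∷≢map-suc : ∀ xs ys → 0 ∷ xs ≢ map suc ys
0∷≢map-suc xs []      ()
0∷≢map-suc xs (_ ∷ _) ()

ascendingLists-unique : ∀ k n → AllPairs _≢_ (ascendingLists k n)
ascendingLists-unique zero    n       = [] ∷ []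
ascendingLists-unique (suc k) zero    =
  AllPairs.map⁺ (AllPairs.map (_∘ ∷-injectiveʳ) (ascendingLists-unique k zero))
ascendingLists-unique (suc k) (suc n) = AllPairs.++⁺
  (AllPairs.map⁺ (AllPairs.map (_∘ ∷-injectiveʳ) (ascendingLists-unique k (suc n))))
  (AllPairs.map⁺ (AllPairs.map (_∘ map-injective suc-injective) (ascendingLists-unique (suc k) n)))
  (All.tabulate λ xs∈ → All.tabulate λ ys∈ → separated xs∈ ys∈)
  where
  separated : ∀ {xs ys} → xs ∈ map (0 ∷_) (ascendingLists k (suc n)) →
              ys ∈ map (map suc) (ascendingLists (suc k) n) → xs ≢ ys
  separated xs∈ ys∈ with xs′ , _ , refl ← ∈-map⁻ (0 ∷_) xs∈ | ys′ , _ , refl ← ∈-map⁻ (map suc) ys∈ =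
    0∷≢map-suc xs′ ys′

≈D-reachable : ∀ {D₀ D E} → D ≈D E → Reachable D₀ D → Reachable D₀ E
≈D-reachable D≈E (base D≈D₀) = base (λ x → ⇔.trans (⇔.sym (D≈E x)) (D≈D₀ x))
≈D-reachable D≈E (step r reach (c , r′ , rowMax , 1≤r′ , r′<r , r′c∉ , between , D⇔)) =
  step r reach (c , r′ , rowMax , 1≤r′ , r′<r , r′c∉ , between , λ x → ⇔.trans (⇔.sym (D≈E x)) (D⇔ x))

module HoleDiagrams (m : ℕ) where

  Row Column : ℕ → Set
  Row a    = 1 ≤ a × a ≤ suc m
  Column b = 1 ≤ b × b ≤ m

  -- f b is the row of the unique empty cell of column b in the box of rows 1…m+1 and columns 1…m.
  Filled : (ℕ → ℕ) → Cell → Set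
  Filled f (a , b) = Row a × Column b × a ≢ f b

  Represents : Diagram → (ℕ → ℕ) → Set
  Represents D f = ∀ x → x ∈ D ⇔ Filled f x

  _≗ᶜ_ : (ℕ → ℕ) → (ℕ → ℕ) → Set
  f ≗ᶜ g = ∀ b → Column b → f b ≡ g b

  offHole? : (f : ℕ → ℕ) (x : Cell) → Dec (proj₁ x ≢ f (proj₂ x))
  offHole? f (a , b) = ¬? (a ≟ f b)

  holeDiagram : (ℕ → ℕ) → Diagram
  holeDiagram f = filter (offHole? f) (cartesianProduct (applyUpTo suc (suc m)) (applyUpTo suc m))

  holeDiagram-represents : ∀ f → Represents (holeDiagram f) f
  holeDiagram-represents f (a , b) = mk⇔ forward backward
    where
    forward : (a , b) ∈ holeDiagram f → Filled f (a , b)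
    forward x∈ with x∈box , a≢fb ← ∈-filter⁻ (offHole? f) x∈
               with a∈ , b∈ ← ∈-cartesianProduct⁻ (applyUpTo suc (suc m)) (applyUpTo suc m) x∈box =
      to ∈-applyUpTo-suc a∈ , to ∈-applyUpTo-suc b∈ , a≢fb
    backward : Filled f (a , b) → (a , b) ∈ holeDiagram f
    backward (row , col , a≢fb) =
      ∈-filter⁺ (offHole? f) (∈-cartesianProduct⁺ (from ∈-applyUpTo-suc row) (from ∈-applyUpTo-suc col)) a≢fb

  𝔻-represents : Represents (𝔻 m) (const 1)
  𝔻-represents (a , b) = mk⇔ forward (backward a b)
    where
    row-cells : ℕ → Diagram
    row-cells i = map (λ j → (suc (suc i) , suc j)) (upTo m)
    forward : (a , b) ∈ 𝔻 m → Filled (const 1) (a , b)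
    forward x∈ with i , i∈ , x∈row ← find (∈-concatMap⁻ row-cells {xs = upTo m} x∈)
               with j , j∈ , refl ← ∈-map⁻ (λ j → (suc (suc i) , suc j)) x∈row =
      (s≤s z≤n , s≤s (∈-upTo⁻ i∈)) , (s≤s z≤n , ∈-upTo⁻ j∈) , λ ()
    backward : ∀ a b → Filled (const 1) (a , b) → (a , b) ∈ 𝔻 m
    backward (suc zero)    b       (_ , _ , 1≢1)               = ⊥-elim (1≢1 refl)
    backward (suc (suc i)) (suc j) ((_ , s≤s i<m) , (_ , j<m) , _) =
      ∈-concatMap⁺ row-cells (lose (∈-upTo⁺ i<m) (∈-map⁺ (λ j → (suc (suc i) , suc j)) (∈-upTo⁺ j<m)))

  represents-≈D : ∀ {D E f} → Represents D f → Represents E f → D ≈D E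
  represents-≈D R S x = ⇔.trans (R x) (⇔.sym (S x))

  filled-resp : ∀ {f g} → f ≗ᶜ g → ∀ {x} → Filled f x → Filled g x
  filled-resp f≗g {a , b} (row , col , a≢fb) = row , col , λ a≡gb → a≢fb (trans a≡gb (sym (f≗g b col)))

  represents-resp : ∀ {D f g} → f ≗ᶜ g → Represents D f → Represents D g
  represents-resp f≗g R x = ⇔.trans (R x) (mk⇔ (filled-resp f≗g) (filled-resp λ b col → sym (f≗g b col)))

  ∉-represents⇒hole : ∀ {D f a b} → Represents D f → Row a → Column b → (a , b) ∉ D → a ≡ f b
  ∉-represents⇒hole {a = a} {b} R row col ab∉D =
    decidable-stable (a ≟ _) λ a≢fb → ab∉D (from (R _) (row , col , a≢fb))

  hole-unique : ∀ {D f g b} → Represents D f → Represents D g → Column b → Row (g b) → g b ≡ f b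
  hole-unique R S col row = ∉-represents⇒hole R row col λ x∈D → proj₂ (proj₂ (to (S _) x∈D)) refl

  raise : (ℕ → ℕ) → ℕ → ℕ → ℕ → ℕ
  raise f c r b with b ≟ c
  ... | yes _ = r
  ... | no _  = f b

  raise-≡ : ∀ f c r → raise f c r c ≡ r
  raise-≡ f c r with c ≟ c
  ... | yes _   = refl
  ... | no c≢c = ⊥-elim (c≢c refl)

  -- Exactly the situation in which the Kohnert move at row r sends the rightmost cell (r , c) into the hole of column c.
  record Raisable (f : ℕ → ℕ) (c r : ℕ) : Set where
    field
      column    : Column c
      1≤hole    : 1 ≤ f c
      hole<r    : f c < r
      r≤1+m     : r ≤ suc m
      rightward : ∀ c′ → c < c′ → c′ ≤ m → f c′ ≡ r

    row-r : Row r
    row-r = ≤-trans 1≤hole (<⇒≤ hole<r) , r≤1+m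

  filled-raise : ∀ {f c r} → Raisable f c r → ∀ x →
                 Filled (raise f c r) x ⇔ ((Filled f x × x ≢ (r , c)) ⊎ x ≡ (f c , c))
  filled-raise {f} {c} {r} ra (a , b) = mk⇔ forward backward
    where
    open Raisable ra
    forward : Filled (raise f c r) (a , b) → (Filled f (a , b) × (a , b) ≢ (r , c)) ⊎ (a , b) ≡ (f c , c)
    forward (row , col , a≢) with b ≟ c
    ... | no b≢c  = inj₁ ((row , col , a≢) , b≢c ∘ cong proj₂)
    ... | yes refl with a ≟ f b
    ...   | yes refl = inj₂ refl
    ...   | no a≢fb  = inj₁ ((row , col , a≢fb) , a≢ ∘ cong proj₁)
    backward : (Filled f (a , b) × (a , b) ≢ (r , c)) ⊎ (a , b) ≡ (f c , c) → Filled (raise f c r) (a , b)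
    backward (inj₁ ((row , col , a≢fb) , ab≢rc)) with b ≟ c
    ... | yes refl = row , col , λ a≡r → ab≢rc (cong (_, b) a≡r)
    ... | no _     = row , col , a≢fb
    backward (inj₂ refl) =
      (1≤hole , ≤-trans (<⇒≤ hole<r) r≤1+m) , column , λ fc≡ → <⇒≢ hole<r (trans fc≡ (raise-≡ f c r))

  moved-cells : ∀ {D f c r} → Represents D f → Raisable f c r → ∀ x →
                ((x ∈ D × x ≢ (r , c)) ⊎ x ≡ (f c , c)) ⇔ Filled (raise f c r) x
  moved-cells R ra x = ⇔.trans ((R x ×-⇔ ⇔.refl) ⊎-⇔ ⇔.refl) (⇔.sym (filled-raise ra x))

  raisable⇒kohnertMove : ∀ {D f c r} → Represents D f → Raisable f c r →
                         KohnertMove r D (holeDiagram (raise f c r))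
  raisable⇒kohnertMove {D} {f} {c} {r} R ra =
    c , f c , (rc∈D , rightmost) , 1≤hole , hole<r , hole∉D , between ,
    λ x → ⇔.trans (holeDiagram-represents _ x) (⇔.sym (moved-cells R ra x))
    where
    open Raisable ra
    rc∈D : (r , c) ∈ D
    rc∈D = from (R _) (row-r , column , λ r≡fc → <⇒≢ hole<r (sym r≡fc))
    rightmost : ∀ c′ → (r , c′) ∈ D → c′ ≤ c
    rightmost c′ rc′∈D with _ , (_ , c′≤m) , r≢fc′ ← to (R _) rc′∈D =
      decidable-stable (c′ ≤? c) λ c′≰c → r≢fc′ (sym (rightward c′ (≰⇒> c′≰c) c′≤m))
    hole∉D : (f c , c) ∉ D
    hole∉D fc∈D = proj₂ (proj₂ (to (R _) fc∈D)) refl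
    between : ∀ r′ → f c < r′ → r′ < r → (r′ , c) ∈ D
    between r′ fc<r′ r′<r =
      from (R _) ((≤-trans (s≤s z≤n) fc<r′ , ≤-trans (<⇒≤ r′<r) r≤1+m) , column ,
                  λ r′≡fc → <⇒≢ fc<r′ (sym r′≡fc))

  kohnertMove⇒raisable : ∀ {D E f r} → Represents D f → KohnertMove r D E →
                         ∃[ c ] Raisable f c r × Represents E (raise f c r)
  kohnertMove⇒raisable {f = f} {r} R (c , r′ , (rc∈D , rightmost) , 1≤r′ , r′<r , r′c∉D , _ , E⇔)
    with (1≤r , r≤1+m) , col , _ ← to (R _) rc∈D
    with refl ← ∉-represents⇒hole R (1≤r′ , ≤-trans (<⇒≤ r′<r) r≤1+m) col r′c∉D =
    c , ra , λ x → ⇔.trans (E⇔ x) (moved-cells R ra x)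
    where
    ra : Raisable f c r
    ra = record
      { column    = col
      ; 1≤hole    = 1≤r′
      ; hole<r    = r′<r
      ; r≤1+m     = r≤1+m
      ; rightward = λ c′ c<c′ c′≤m →
          sym (∉-represents⇒hole R (1≤r , r≤1+m) (≤-trans (s≤s z≤n) c<c′ , c′≤m)
                                 λ rc′∈D → <⇒≱ c<c′ (rightmost c′ rc′∈D))
      }

  Valid : (ℕ → ℕ) → Set
  Valid f = (∀ b → Column b → Row (f b)) × (∀ b b′ → 1 ≤ b → b ≤ b′ → b′ ≤ m → f b ≤ f b′)

  raise-valid : ∀ {f c r} → Valid f → Raisable f c r → Valid (raise f c r)
  raise-valid {f} {c} {r} (rows , mono) ra = rows′ , mono′
    where
    open Raisable ra
    rows′ : ∀ b → Column b → Row (raise f c r b)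
    rows′ b col with b ≟ c
    ... | yes _ = row-r
    ... | no _  = rows b col
    mono′ : ∀ b b′ → 1 ≤ b → b ≤ b′ → b′ ≤ m → raise f c r b ≤ raise f c r b′
    mono′ b b′ 1≤b b≤b′ b′≤m with b ≟ c | b′ ≟ c
    ... | yes _    | yes _    = ≤-refl
    ... | yes refl | no b′≢c  = ≤-reflexive (sym (rightward b′ (≤∧≢⇒< b≤b′ (b′≢c ∘ sym)) b′≤m))
    ... | no _     | yes refl = ≤-trans (mono b c 1≤b b≤b′ (proj₂ column)) (<⇒≤ hole<r)
    ... | no _     | no _     = mono b b′ 1≤b b≤b′ b′≤m

  reachable⇒valid : ∀ {D} → Reachable (𝔻 m) D → ∃[ f ] Valid f × Represents D f
  reachable⇒valid (base D≈𝔻) =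
    const 1 , ((λ _ _ → ≤-refl , s≤s z≤n) , (λ _ _ _ _ _ → ≤-refl)) ,
    λ x → ⇔.trans (D≈𝔻 x) (𝔻-represents x)
  reachable⇒valid (step r reach move) with f , valid , R ← reachable⇒valid reach
                                      with c , ra , R′ ← kohnertMove⇒raisable R move =
    raise f c r , raise-valid valid ra , R′

  ReachableHoles : (ℕ → ℕ) → Set
  ReachableHoles f = Reachable (𝔻 m) (holeDiagram f)

  reachableHoles-resp : ∀ {f g} → f ≗ᶜ g → ReachableHoles f → ReachableHoles g
  reachableHoles-resp f≗g =
    ≈D-reachable (represents-≈D (holeDiagram-represents _)
                                (represents-resp (λ b col → sym (f≗g b col)) (holeDiagram-represents _)))

  reachableHoles-raise : ∀ {f c r} → Raisable f c r → ReachableHoles f → ReachableHoles (raise f c r)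
  reachableHoles-raise {r = r} ra reach = step r reach (raisable⇒kohnertMove (holeDiagram-represents _) ra)

  reachableHoles-const1 : ReachableHoles (const 1)
  reachableHoles-const1 = base (represents-≈D (holeDiagram-represents (const 1)) 𝔻-represents)

  setBeyond : (ℕ → ℕ) → ℕ → ℕ → ℕ → ℕ
  setBeyond g t v b with b ≤? t
  ... | yes _ = g b
  ... | no _  = v

  setBeyond-≤ : ∀ g t v {b} → b ≤ t → setBeyond g t v b ≡ g b
  setBeyond-≤ g t v {b} b≤t with b ≤? t
  ... | yes _   = refl
  ... | no b≰t = ⊥-elim (b≰t b≤t)

  setBeyond-> : ∀ g t v {b} → t < b → setBeyond g t v b ≡ v
  setBeyond-> g t v {b} t<b with b ≤? t
  ... | yes b≤t = ⊥-elim (<⇒≱ t<b b≤t)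
  ... | no _    = refl

  setBeyond-step : ∀ {g s u v} → suc s ≤ m → g (suc s) ≡ u → 1 ≤ u → u < v → v ≤ suc m →
                   ReachableHoles (setBeyond g (suc s) v) → ReachableHoles (setBeyond g s v)
  setBeyond-step {g} {s} {u} {v} 1+s≤m g[1+s]≡u 1≤u u<v v≤1+m reach =
    reachableHoles-resp lowered (reachableHoles-raise ra reach)
    where
    hole≡u : setBeyond g (suc s) v (suc s) ≡ u
    hole≡u = trans (setBeyond-≤ g (suc s) v ≤-refl) g[1+s]≡u
    ra : Raisable (setBeyond g (suc s) v) (suc s) v
    ra = record
      { column    = s≤s z≤n , 1+s≤m
      ; 1≤hole    = subst (1 ≤_) (sym hole≡u) 1≤u
      ; hole<r    = subst (_< v) (sym hole≡u) u<v
      ; r≤1+m     = v≤1+m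
      ; rightward = λ _ 1+s<c′ _ → setBeyond-> g (suc s) v 1+s<c′
      }
    lowered : raise (setBeyond g (suc s) v) (suc s) v ≗ᶜ setBeyond g s v
    lowered b _ with b ≟ suc s | ≤-<-connex b s
    ... | yes refl | _        = sym (setBeyond-> g s v ≤-refl)
    ... | no _     | inj₁ b≤s = trans (setBeyond-≤ g (suc s) v (m≤n⇒m≤1+n b≤s)) (sym (setBeyond-≤ g s v b≤s))
    ... | no b≢1+s | inj₂ s<b =
      trans (setBeyond-> g (suc s) v (≤∧≢⇒< s<b (b≢1+s ∘ sym))) (sym (setBeyond-> g s v s<b))

  -- The holes of columns m, m-1, …, t+1 are raised from row u to row v in this order, so that
  -- the column being raised always holds the rightmost cell of row v.
  setBeyond-reachable : ∀ {g t u v} → t ≤ m → (∀ b → t < b → b ≤ m → g b ≡ u) →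
                        1 ≤ u → u ≤ v → v ≤ suc m → ReachableHoles g → ReachableHoles (setBeyond g t v)
  setBeyond-reachable {g} {t} {u} {v} t≤m beyond-t 1≤u u≤v v≤1+m reach with m≤n⇒m<n∨m≡n u≤v
  ... | inj₂ refl = reachableHoles-resp unchanged reach
    where
    unchanged : g ≗ᶜ setBeyond g t u
    unchanged b (_ , b≤m) with ≤-<-connex b t
    ... | inj₁ b≤t = sym (setBeyond-≤ g t u b≤t)
    ... | inj₂ t<b = trans (beyond-t b t<b b≤m) (sym (setBeyond-> g t u t<b))
  ... | inj₁ u<v = go (m ∸ t) t (m+[n∸m]≡n t≤m) ≤-refl
    where
    go : ∀ d s → s + d ≡ m → t ≤ s → ReachableHoles (setBeyond g s v)
    go zero    s s+0≡m _ = reachableHoles-resp settled reach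
      where
      settled : g ≗ᶜ setBeyond g s v
      settled b (_ , b≤m) = sym (setBeyond-≤ g s v (subst (b ≤_) (trans (sym s+0≡m) (+-identityʳ s)) b≤m))
    go (suc d) s s+1+d≡m t≤s =
      setBeyond-step 1+s≤m (beyond-t (suc s) (s≤s t≤s) 1+s≤m) 1≤u u<v v≤1+m
        (go d (suc s) 1+s+d≡m (m≤n⇒m≤1+n t≤s))
      where
      1+s+d≡m : suc s + d ≡ m
      1+s+d≡m = trans (sym (+-suc s d)) s+1+d≡m
      1+s≤m : suc s ≤ m
      1+s≤m = subst (suc s ≤_) 1+s+d≡m (m≤m+n (suc s) d)

  prefix-reachable : ∀ {f} → Valid f → ∀ j → 1 ≤ j → j ≤ m → ReachableHoles (λ b → f (b ⊓ j))
  prefix-reachable {f} (rows , _) 1 _ 1≤m =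
    reachableHoles-resp first
      (setBeyond-reachable z≤n (λ _ _ _ → refl) ≤-refl (proj₁ row-f1) (proj₂ row-f1) reachableHoles-const1)
    where
    row-f1 : Row (f 1)
    row-f1 = rows 1 (≤-refl , 1≤m)
    first : setBeyond (const 1) 0 (f 1) ≗ᶜ (λ b → f (b ⊓ 1))
    first b (1≤b , _) = trans (setBeyond-> (const 1) 0 (f 1) 1≤b) (cong f (sym (m≥n⇒m⊓n≡n 1≤b)))
  prefix-reachable {f} valid@(rows , mono) (suc (suc j)) _ 2+j≤m =
    reachableHoles-resp extended
      (setBeyond-reachable 1+j≤m (λ b 1+j<b _ → cong f (m≥n⇒m⊓n≡n (<⇒≤ 1+j<b)))
        (proj₁ (rows (suc j) (s≤s z≤n , 1+j≤m))) (mono (suc j) (suc (suc j)) (s≤s z≤n) (n≤1+n _) 2+j≤m)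
        (proj₂ (rows (suc (suc j)) (s≤s z≤n , 2+j≤m)))
        (prefix-reachable valid (suc j) (s≤s z≤n) 1+j≤m))
    where
    1+j≤m : suc j ≤ m
    1+j≤m = ≤-trans (n≤1+n _) 2+j≤m
    extended : setBeyond (λ b → f (b ⊓ suc j)) (suc j) (f (suc (suc j))) ≗ᶜ (λ b → f (b ⊓ suc (suc j)))
    extended b _ with ≤-<-connex b (suc j)
    ... | inj₁ b≤1+j = trans (setBeyond-≤ _ (suc j) _ b≤1+j)
                             (cong f (trans (m≤n⇒m⊓n≡m b≤1+j) (sym (m≤n⇒m⊓n≡m (m≤n⇒m≤1+n b≤1+j)))))
    ... | inj₂ 1+j<b = trans (setBeyond-> _ (suc j) _ 1+j<b) (cong f (sym (m≥n⇒m⊓n≡n 1+j<b)))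

  valid⇒reachableHoles : ∀ {f} → 1 ≤ m → Valid f → ReachableHoles f
  valid⇒reachableHoles {f} 1≤m valid =
    reachableHoles-resp (λ b (_ , b≤m) → cong f (m≤n⇒m⊓n≡m b≤m)) (prefix-reachable valid m 1≤m ≤-refl)

-- Hole rows are 1 + the entries of an ascending list; columns are 1-based, list positions 0-based.
profile : List ℕ → ℕ → ℕ
profile xs b = suc (nth xs (pred b))

module KeyDiagramCount (m : ℕ) where
  open HoleDiagrams m

  ascendingList⇒valid : ∀ {xs} → AscendingList m m xs → Valid (profile xs)
  ascendingList⇒valid {xs} (ascendingList _ (bound , mono)) = rows , mono′
    where
    rows : ∀ b → Column b → Row (profile xs b)
    rows (suc i) (_ , i<m) = s≤s z≤n , s≤s (bound i i<m)
    mono′ : ∀ b b′ → 1 ≤ b → b ≤ b′ → b′ ≤ m → profile xs b ≤ profile xs b′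
    mono′ (suc i) (suc j) _ (s≤s i≤j) j<m = s≤s (mono i j i≤j j<m)

  valid⇒ascending : ∀ {f} → Valid f → Ascending m m (pred ∘ f ∘ suc)
  valid⇒ascending (rows , mono) =
    (λ i i<m → pred-mono-≤ (proj₂ (rows (suc i) (s≤s z≤n , i<m)))) ,
    (λ i j i≤j j<m → pred-mono-≤ (mono (suc i) (suc j) (s≤s z≤n) (s≤s i≤j) j<m))

  valid⇒listed : ∀ {f} → Valid f → ∃[ xs ] xs ∈ ascendingLists m m × profile xs ≗ᶜ f
  valid⇒listed {f} valid@(rows , _)
    with xs , xs∈ , nth≡ ← ascendingLists-complete m m (pred ∘ f ∘ suc) (valid⇒ascending valid) =
    xs , xs∈ , profile≗f
    where
    profile≗f : profile xs ≗ᶜ f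
    profile≗f (suc i) (_ , i<m) =
      trans (cong suc (nth≡ i i<m)) (suc-pred (f (suc i)) {{>-nonZero (proj₁ (rows (suc i) (s≤s z≤n , i<m)))}})

  diagramOf : List ℕ → Diagram
  diagramOf xs = holeDiagram (profile xs)

  KD : List Diagram
  KD = map diagramOf (ascendingLists m m)

  reachable⇒listed : ∀ D → Reachable (𝔻 m) D → Any (D ≈D_) KD
  reachable⇒listed D reach
    with f , valid , R ← reachable⇒valid reach
    with xs , xs∈ , profile≗f ← valid⇒listed valid =
    Any.map⁺ (lose xs∈ (represents-≈D R (represents-resp profile≗f (holeDiagram-represents _))))

  listed⇒reachable : 1 ≤ m → ∀ D → Any (D ≈D_) KD → Reachable (𝔻 m) D
  listed⇒reachable 1≤m D D∈ with xs , xs∈ , D≈ ← find (Any.map⁻ D∈) =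
    ≈D-reachable (λ x → ⇔.sym (D≈ x))
      (valid⇒reachableHoles 1≤m (ascendingList⇒valid (All.lookup (ascendingLists-sound m m) xs∈)))

  diagramOf-injective : ∀ {xs ys} → AscendingList m m xs → AscendingList m m ys →
                        diagramOf xs ≈D diagramOf ys → xs ≡ ys
  diagramOf-injective {xs} {ys} asc-xs asc-ys xs≈ys =
    nth-ext xs ys (trans (length≡ asc-xs) (sym (length≡ asc-ys))) same-entry
    where
    open AscendingList using (length≡)
    ys-represents : Represents (diagramOf xs) (profile ys)
    ys-represents x = ⇔.trans (xs≈ys x) (holeDiagram-represents (profile ys) x)
    same-entry : ∀ i → i < length xs → nth xs i ≡ nth ys i
    same-entry i i<len = suc-injective (sym (hole-unique (holeDiagram-represents (profile xs)) ys-represents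
                                                          col (proj₁ (ascendingList⇒valid asc-ys) (suc i) col)))
      where
      col : Column (suc i)
      col = s≤s z≤n , subst (i <_) (length≡ asc-xs) i<len

  KD-distinct : AllPairs (λ A B → ¬ (A ≈D B)) KD
  KD-distinct = AllPairs.map⁺ (allPairs-mapWith∈ separated (ascendingLists-unique m m))
    where
    separated : ∀ {xs ys} → xs ∈ ascendingLists m m → ys ∈ ascendingLists m m →
                xs ≢ ys → ¬ (diagramOf xs ≈D diagramOf ys)
    separated xs∈ ys∈ xs≢ys = xs≢ys ∘ diagramOf-injective (All.lookup (ascendingLists-sound m m) xs∈)
                                                          (All.lookup (ascendingLists-sound m m) ys∈)

  length-KD : length KD ≡ (2 * m) C m
  length-KD = begin
    length KD                       ≡⟨ length-map diagramOf (ascendingLists m m) ⟩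
    length (ascendingLists m m)     ≡⟨ length-ascendingLists m m ⟩
    (m + m) C m                     ≡⟨ cong (λ n → (m + n) C m) (sym (+-identityʳ m)) ⟩
    (2 * m) C m                     ∎
    where open ≡-Reasoning

corollary7p4 : ∀ (m : ℕ) → m ≥ 1 → KDCard (𝔻 m) ((2 * m) C m)
corollary7p4 m 1≤m = KD , (λ D → mk⇔ (reachable⇒listed D) (listed⇒reachable 1≤m D)) , KD-distinct , length-KD
  where open KeyDiagramCount m
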